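{- Let $D$ be a finite digraph, $k\ge2$, $\lambda:V(D)\to\mathbb{Z}_k$ a labeling, $\sigma=v_1,\dots,v_n$ an ordering of $V(D)$, and $S$ the feedback arc set with respect to $\sigma$. (1) Starting from $\lambda$, the vertices of $D$ can be toggled in such a way that every vertex that is not a head feedback vertex has label $0$. (2) Suppose $\lambda(v_i)=0$ for every $v_i$ that is not a head feedback vertex. Suppose we toggle $v_1$ some number of times, then $v_2$ some number of times, and so on up to $v_n$, in such a way that at the end each non-head feedback vertex has label $0$. Then each non-head feedback vertex $v_i$ is toggled $-b_i$ times (mod $k$), where $b_i$ is the label of $v_i$ right after $v_{i-1}$ has been toggled (for $i=1$, $b_1=\lambda(v_1)$).
   Context: The $k$-lights out game on $D$: toggling a vertex $v$ increases by $1$ (mod $k$) the label of $v$ and of every $w$ with $vw\in A(D)$. For an ordering $\sigma=v_1,\dots,v_n$, the feedback arc set with respect to $\sigma$ is the set $S$ of arcs $v_jv_i\in A(D)$ with $i<j$; if $vw\in S$ then $w$ is called a head feedback vertex. -}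

module Defs where

open import Data.Nat using (ℕ; zero; suc; _+_; _*_; _<_; _<ᵇ_; _%_; NonZero)
open import Data.Fin using (Fin; toℕ)
open import Data.Fin.Properties using (_≟_)
open import Data.Bool using (Bool; true; false; if_then_else_)
open import Data.List using (List; map; allFin)
open import Data.Nat.ListAction using (sum)
open import Data.Product using (∃; _×_)
open import Relation.Binary.PropositionalEquality using (_≡_)
open import Relation.Nullary using (does)
open import Function.Bundles using (_↔_; Inverse)

-- A finite digraph on vertex set Fin n: arc relation given as a Boolean
-- adjacency function (arc v w means v → w).  Digraphs are loopless.
Digraph : ℕ → Set
Digraph n = Fin n → Fin n → Bool

Loopless : ∀ {n} → Digraph n → Set
Loopless {n} D = ∀ (v : Fin n) → D v v ≡ false

-- An ordering σ = v_1,…,v_n of V(D): a bijection from positions to vertices.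
Ordering : ℕ → Set
Ordering n = Fin n ↔ Fin n

vtx : ∀ {n} → Ordering n → Fin n → Fin n
vtx σ = Inverse.to σ

pos : ∀ {n} → Ordering n → Fin n → Fin n
pos σ = Inverse.from σ

-- Feedback arc set w.r.t. σ: arcs v w with pos w < pos v.
-- w is a head feedback vertex iff it is the head of such an arc.
HeadFeedback : ∀ {n} → Digraph n → Ordering n → Fin n → Set
HeadFeedback {n} D σ w =
  ∃ λ (v : Fin n) → (D v w ≡ true) × (toℕ (pos σ w) < toℕ (pos σ v))

b2n : Bool → ℕ
b2n true  = 1
b2n false = 0

toggleEffect : ∀ {n} → Digraph n → Fin n → Fin n → ℕ
toggleEffect D v w = b2n (does (v ≟ w)) + b2n (D v w)

-- Toggle sequence: t j = number of times the j-th vertex v_j = vtx σ j is toggled;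
-- vertices are toggled in order v_1 (t 1 times), v_2, …, v_n.
-- labelAfter m w = label of w (as an element of ℤ_k, represented in {0..k-1})
-- after the vertices at positions 0,…,m-1 have been toggled.
labelAfter : ∀ {n} (k : ℕ) ⦃ _ : NonZero k ⦄ → Digraph n → Ordering n →
             (Fin n → Fin k) → (Fin n → ℕ) → ℕ → Fin n → ℕ
labelAfter {n} k D σ lab t m w =
  (toℕ (lab w) +
   sum (map (λ j → if toℕ j <ᵇ m then t j * toggleEffect D (vtx σ j) w else 0)
            (allFin n))) % k

finalLabel : ∀ {n} (k : ℕ) ⦃ _ : NonZero k ⦄ → Digraph n → Ordering n →
             (Fin n → Fin k) → (Fin n → ℕ) → Fin n → ℕ
finalLabel {n} k D σ lab t = labelAfter k D σ lab t n

{-# OPTIONS --safe #-}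
-- Let w = v_p be a vertex that is not a head feedback vertex.  No later vertex
-- v_j (j > p) has an arc into w, so the label of w only changes while
-- v_1, …, v_p are toggled: its final label is b_p + t_p, where b_p is its label
-- just before v_p is toggled.  This gives (2) at once, and (1) by choosing the
-- toggle counts greedily in the order σ, t_p = −b_p.
module Submission where

open import Defs
open import Data.Nat using (ℕ; zero; suc; _+_; _*_; _∸_; _≤_; _<_; _<ᵇ_; _≡ᵇ_; _%_; NonZero)
open import Data.Nat.Properties
  using (+-assoc; +-comm; +-identityʳ; *-identityʳ; *-zeroʳ; <⇒<ᵇ; <ᵇ⇒<; <-irrefl; <-asym;
         <⇒≤; ≤-pred; ≤∧≢⇒<; ≡⇒≡ᵇ; ≡ᵇ⇒≡; m∸n+n≡m)
  renaming (_≟_ to _≟ℕ_)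
open import Data.Nat.DivMod using (%-distribˡ-+; m%n%n≡m%n; m%n<n; n%n≡0)
open import Data.Fin using (Fin; toℕ; zero; suc)
open import Data.Fin.Properties using (_≟_; toℕ<n) renaming (<-cmp to <-cmpFin)
open import Data.Bool using (true; false; if_then_else_; T)
open import Data.List using (List; []; _∷_; map; allFin; tabulate)
open import Data.List.Properties using (map-cong; map-tabulate)
open import Data.Nat.ListAction using (sum)
open import Data.Product using (∃; _×_; _,_)
open import Function using (id; _∘_)
open import Function.Bundles using (Inverse)
open import Relation.Binary.PropositionalEquality
open import Relation.Binary.Definitions using (tri<; tri≈; tri>)
open import Relation.Nullary using (¬_; does; yes; no; contradiction)

open ≡-Reasoning

T⇒≡true : ∀ {b} → T b → b ≡ true
T⇒≡true {true} _ = refl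

¬T⇒≡false : ∀ {b} → ¬ T b → b ≡ false
¬T⇒≡false {false} _ = refl
¬T⇒≡false {true}  ¬t = contradiction _ ¬t

sum-map-+ : ∀ {A : Set} (f g : A → ℕ) (xs : List A) →
            sum (map (λ x → f x + g x) xs) ≡ sum (map f xs) + sum (map g xs)
sum-map-+ f g []       = refl
sum-map-+ f g (x ∷ xs) = begin
  f x + g x + sum (map (λ x → f x + g x) xs) ≡⟨ cong (f x + g x +_) (sum-map-+ f g xs) ⟩
  f x + g x + (F + G)                        ≡⟨ +-assoc (f x) (g x) (F + G) ⟩
  f x + (g x + (F + G))                      ≡⟨ cong (f x +_) (+-comm (g x) (F + G)) ⟩
  f x + ((F + G) + g x)                      ≡⟨ cong (f x +_) (+-assoc F G (g x)) ⟩
  f x + (F + (G + g x))                      ≡⟨ cong (λ y → f x + (F + y)) (+-comm G (g x)) ⟩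
  f x + (F + (g x + G))                      ≡⟨ +-assoc (f x) F (g x + G) ⟨
  (f x + F) + (g x + G)                      ∎
  where F = sum (map f xs); G = sum (map g xs)

sum-tabulate-zero : ∀ n → sum (tabulate {n = n} (λ _ → 0)) ≡ 0
sum-tabulate-zero zero    = refl
sum-tabulate-zero (suc n) = sum-tabulate-zero n

indicator : ∀ {n} → Fin n → ℕ → Fin n → ℕ
indicator p c j = if does (j ≟ p) then c else 0

sum-allFin-indicator : ∀ {n} (p : Fin n) c → sum (map (indicator p c) (allFin n)) ≡ c
sum-allFin-indicator p c = trans (cong sum (map-tabulate id (indicator p c))) (sum-tabulate p)
  where
  sum-tabulate : ∀ {n} (p : Fin n) → sum (tabulate (indicator p c)) ≡ c
  sum-tabulate {suc n} zero    = trans (cong (c +_) (sum-tabulate-zero n)) (+-identityʳ c)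
  sum-tabulate {suc n} (suc p) = sum-tabulate p

+-%-absorbʳ : ∀ a b k .⦃ _ : NonZero k ⦄ → (a + b % k) % k ≡ (a + b) % k
+-%-absorbʳ a b k = begin
  (a + b % k) % k         ≡⟨ %-distribˡ-+ a (b % k) k ⟩
  (a % k + b % k % k) % k ≡⟨ cong (λ x → (a % k + x) % k) (m%n%n≡m%n b k) ⟩
  (a % k + b % k) % k     ≡⟨ %-distribˡ-+ a b k ⟨
  (a + b) % k             ∎

toggleEffect-self : ∀ {n} (D : Digraph n) → Loopless D → ∀ v → toggleEffect D v v ≡ 1
toggleEffect-self D loopless v with v ≟ v
... | yes _ rewrite loopless v = refl
... | no v≢v = contradiction refl v≢v

toggleEffect-nonadjacent : ∀ {n} (D : Digraph n) {v w} → v ≢ w → D v w ≡ false →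
                           toggleEffect D v w ≡ 0
toggleEffect-nonadjacent D {v} {w} v≢w noArc with v ≟ w
... | yes v≡w = contradiction v≡w v≢w
... | no _ rewrite noArc = refl

module Toggling {n : ℕ} (D : Digraph n) (σ : Ordering n) where

  pos∘vtx : ∀ j → pos σ (vtx σ j) ≡ j
  pos∘vtx = Inverse.strictlyInverseʳ σ

  vtx∘pos : ∀ w → vtx σ (pos σ w) ≡ w
  vtx∘pos = Inverse.strictlyInverseˡ σ

  noArc-from-later : ∀ {p j} → ¬ HeadFeedback D σ (vtx σ p) → toℕ p < toℕ j →
                     D (vtx σ j) (vtx σ p) ≡ false
  noArc-from-later {p} {j} notHead p<j with D (vtx σ j) (vtx σ p) in arc
  ... | false = refl
  ... | true  = contradiction (vtx σ j , arc , later) notHead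
    where later = subst₂ (λ a b → toℕ a < toℕ b) (sym (pos∘vtx p)) (sym (pos∘vtx j)) p<j

  contribution : (Fin n → ℕ) → ℕ → Fin n → Fin n → ℕ
  contribution t m w j = if toℕ j <ᵇ m then t j * toggleEffect D (vtx σ j) w else 0

  contribution-counted : ∀ t {m} w j → toℕ j < m →
                         contribution t m w j ≡ t j * toggleEffect D (vtx σ j) w
  contribution-counted t w j j<m rewrite T⇒≡true (<⇒<ᵇ j<m) = refl

  contribution-uncounted : ∀ t {m} w j → ¬ toℕ j < m → contribution t m w j ≡ 0
  contribution-uncounted t {m} w j j≮m
    rewrite ¬T⇒≡false {toℕ j <ᵇ m} (j≮m ∘ <ᵇ⇒< (toℕ j) m) = refl

  contribution-cong : ∀ t t' m w → (∀ j → toℕ j < m → t j ≡ t' j) →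
                      ∀ j → contribution t m w j ≡ contribution t' m w j
  contribution-cong t t' m w agree j with toℕ j <ᵇ m in j<ᵇm
  ... | true  = cong (_* toggleEffect D (vtx σ j) w) (agree j (<ᵇ⇒< _ _ (subst T (sym j<ᵇm) _)))
  ... | false = refl

  contribution-split : Loopless D → ∀ t p → ¬ HeadFeedback D σ (vtx σ p) → ∀ j →
                       contribution t n (vtx σ p) j ≡
                       contribution t (toℕ p) (vtx σ p) j + indicator p (t p) j
  contribution-split loopless t p notHead j with <-cmpFin j p | j ≟ p
  ... | tri< j<p _ _ | no _ = begin
    contribution t n w j            ≡⟨ contribution-counted t w j (toℕ<n j) ⟩
    t j * toggleEffect D (vtx σ j) w ≡⟨ contribution-counted t w j j<p ⟨
    contribution t (toℕ p) w j      ≡⟨ +-identityʳ _ ⟨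
    contribution t (toℕ p) w j + 0  ∎
    where w = vtx σ p
  ... | tri< j<p j≢p _ | yes j≡p = contradiction j≡p j≢p
  ... | tri≈ _ refl _ | yes _ = begin
    contribution t n w p                    ≡⟨ contribution-counted t w p (toℕ<n p) ⟩
    t p * toggleEffect D w w                ≡⟨ cong (t p *_) (toggleEffect-self D loopless w) ⟩
    t p * 1                                 ≡⟨ *-identityʳ (t p) ⟩
    t p                                     ≡⟨ cong (_+ t p) (contribution-uncounted t w p (<-irrefl refl)) ⟨
    contribution t (toℕ p) w p + t p        ∎
    where w = vtx σ p
  ... | tri≈ _ j≡p _ | no j≢p = contradiction j≡p j≢p
  ... | tri> _ _ p<j | yes refl = contradiction p<j (<-irrefl refl)
  ... | tri> _ _ p<j | no _ = begin
    contribution t n w j            ≡⟨ contribution-counted t w j (toℕ<n j) ⟩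
    t j * toggleEffect D (vtx σ j) w ≡⟨ cong (t j *_) (toggleEffect-nonadjacent D vj≢w (noArc-from-later notHead p<j)) ⟩
    t j * 0                         ≡⟨ *-zeroʳ (t j) ⟩
    0                               ≡⟨ contribution-uncounted t w j (<-asym p<j) ⟨
    contribution t (toℕ p) w j      ≡⟨ +-identityʳ _ ⟨
    contribution t (toℕ p) w j + 0  ∎
    where
    w = vtx σ p
    vj≢w : vtx σ j ≢ w
    vj≢w e = <-irrefl (cong toℕ (trans (sym (pos∘vtx p)) (trans (cong (pos σ) (sym e)) (pos∘vtx j)))) p<j

  module Labels (k : ℕ) ⦃ _ : NonZero k ⦄ (lab : Fin n → Fin k) where

    labelAfter<k : ∀ t m w → labelAfter k D σ lab t m w < k
    labelAfter<k t m w = m%n<n _ k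

    labelAfter-cong : ∀ t t' m w → (∀ j → toℕ j < m → t j ≡ t' j) →
                      labelAfter k D σ lab t m w ≡ labelAfter k D σ lab t' m w
    labelAfter-cong t t' m w agree =
      cong (λ xs → (toℕ (lab w) + sum xs) % k) (map-cong (contribution-cong t t' m w agree) (allFin n))

    finalLabel-nonHead : Loopless D → ∀ t p → ¬ HeadFeedback D σ (vtx σ p) →
                         finalLabel k D σ lab t (vtx σ p) ≡
                         (t p + labelAfter k D σ lab t (toℕ p) (vtx σ p)) % k
    finalLabel-nonHead loopless t p notHead = begin
      (a + sum (map (contribution t n w) (allFin n))) % k
        ≡⟨ cong (λ x → (a + x) % k) sum-split ⟩
      (a + (S + t p)) % k  ≡⟨ cong (_% k) (+-assoc a S (t p)) ⟨
      (a + S + t p) % k    ≡⟨ cong (_% k) (+-comm (a + S) (t p)) ⟩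
      (t p + (a + S)) % k  ≡⟨ +-%-absorbʳ (t p) (a + S) k ⟨
      (t p + labelAfter k D σ lab t (toℕ p) w) % k ∎
      where
      w = vtx σ p
      a = toℕ (lab w)
      S = sum (map (contribution t (toℕ p) w) (allFin n))
      sum-split : sum (map (contribution t n w) (allFin n)) ≡ S + t p
      sum-split = begin
        sum (map (contribution t n w) (allFin n))
          ≡⟨ cong sum (map-cong (contribution-split loopless t p notHead) (allFin n)) ⟩
        sum (map (λ j → contribution t (toℕ p) w j + indicator p (t p) j) (allFin n))
          ≡⟨ sum-map-+ (contribution t (toℕ p) w) (indicator p (t p)) (allFin n) ⟩
        S + sum (map (indicator p (t p)) (allFin n))
          ≡⟨ cong (S +_) (sum-allFin-indicator p (t p)) ⟩
        S + t p ∎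

    -- greedy m sets t_j = −b_j, represented as k ∸ b_j, for positions j < m and 0 elsewhere.
    greedy : ℕ → Fin n → ℕ
    greedy zero    j = 0
    greedy (suc m) j =
      if toℕ j ≡ᵇ m then k ∸ labelAfter k D σ lab (greedy m) m (vtx σ j) else greedy m j

    greedy-stable : ∀ m j → toℕ j < m → greedy m j ≡ greedy (suc (toℕ j)) j
    greedy-stable (suc m) j j<1+m with toℕ j ≟ℕ m
    ... | yes refl = refl
    ... | no j≢m rewrite ¬T⇒≡false {toℕ j ≡ᵇ m} (j≢m ∘ ≡ᵇ⇒≡ (toℕ j) m) =
      greedy-stable m j (≤∧≢⇒< (≤-pred j<1+m) j≢m)

    greedy-newest : ∀ p → greedy (suc (toℕ p)) p ≡ k ∸ labelAfter k D σ lab (greedy (toℕ p)) (toℕ p) (vtx σ p)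
    greedy-newest p rewrite T⇒≡true (≡⇒≡ᵇ (toℕ p) (toℕ p) refl) = refl

    greedy-count : ∀ p → greedy n p ≡ k ∸ labelAfter k D σ lab (greedy n) (toℕ p) (vtx σ p)
    greedy-count p = begin
      greedy n p                ≡⟨ greedy-stable n p (toℕ<n p) ⟩
      greedy (suc (toℕ p)) p    ≡⟨ greedy-newest p ⟩
      k ∸ labelAfter k D σ lab (greedy (toℕ p)) (toℕ p) (vtx σ p)
        ≡⟨ cong (k ∸_) (labelAfter-cong _ _ (toℕ p) (vtx σ p) agree) ⟨
      k ∸ labelAfter k D σ lab (greedy n) (toℕ p) (vtx σ p) ∎
      where
      agree : ∀ j → toℕ j < toℕ p → greedy n j ≡ greedy (toℕ p) j
      agree j j<p = trans (greedy-stable n j (toℕ<n j)) (sym (greedy-stable (toℕ p) j j<p))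

    greedy-clears-nonHead : Loopless D → ∀ w → ¬ HeadFeedback D σ w →
                            finalLabel k D σ lab (greedy n) w ≡ 0
    greedy-clears-nonHead loopless w notHead = begin
      finalLabel k D σ lab (greedy n) w             ≡⟨ cong (finalLabel k D σ lab (greedy n)) (vtx∘pos w) ⟨
      finalLabel k D σ lab (greedy n) (vtx σ p)     ≡⟨ finalLabel-nonHead loopless (greedy n) p notHead′ ⟩
      (greedy n p + L) % k                          ≡⟨ cong (λ c → (c + L) % k) (greedy-count p) ⟩
      (k ∸ L + L) % k                               ≡⟨ cong (_% k) (m∸n+n≡m (<⇒≤ (labelAfter<k (greedy n) (toℕ p) (vtx σ p)))) ⟩
      k % k                                         ≡⟨ n%n≡0 k ⟩
      0                                             ∎
      where
      p = pos σ w
      L = labelAfter k D σ lab (greedy n) (toℕ p) (vtx σ p)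
      notHead′ : ¬ HeadFeedback D σ (vtx σ p)
      notHead′ = subst (¬_ ∘ HeadFeedback D σ) (sym (vtx∘pos w)) notHead

mainTheorem6 :
    (n : ℕ) (D : Digraph n) → Loopless D →
    (k : ℕ) ⦃ _ : NonZero k ⦄ → 2 ≤ k →
    (lab : Fin n → Fin k) (σ : Ordering n) →
    (∃ λ (t : Fin n → ℕ) →
       ∀ (w : Fin n) → ¬ HeadFeedback D σ w → finalLabel k D σ lab t w ≡ 0)
    ×
    (∀ (t : Fin n → ℕ) →
       (∀ (w : Fin n) → ¬ HeadFeedback D σ w → toℕ (lab w) ≡ 0) →
       (∀ (w : Fin n) → ¬ HeadFeedback D σ w → finalLabel k D σ lab t w ≡ 0) →
       ∀ (i : Fin n) → ¬ HeadFeedback D σ (vtx σ i) →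
       (t i + labelAfter k D σ lab t (toℕ i) (vtx σ i)) % k ≡ 0)
mainTheorem6 n D loopless k _ lab σ =
    (greedy n , greedy-clears-nonHead loopless)
  , λ t _ cleared i notHead →
      trans (sym (finalLabel-nonHead loopless t i notHead)) (cleared (vtx σ i) notHead)
  where open Toggling.Labels D σ k lab
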